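{- Weak bisimilarity $\approx$ on $(E,R)\,\mathsf{itree}$ is an equivalence relation. For all $P,Q$ and all $m,n\in\mathbb{N}$, if $P\approx Q$ then $\tau^m P\approx\tau^n Q$. For all $P$, if $P\approx\mathsf{div}$ then $P=\mathsf{div}$.
   Context: For a set $E$ of events and a set $R$ of return values, $(E,R)\,\mathsf{itree}$ is the coinductive datatype (possibly infinite trees) with constructors $\mathsf{Ret}\,r$ ($r\in R$), $\mathsf{Sil}\,P$ (written $\tau P$), and $\mathsf{Vis}\,F$ with $F: E\rightharpoonup (E,R)\,\mathsf{itree}$ a partial function. $\tau^n P$ is $n$-fold $\mathsf{Sil}$; $\mathsf{div}$ is defined corecursively by $\mathsf{div}=\mathsf{Sil}\,\mathsf{div}$. $P$ is stable if it is not of the form $\mathsf{Sil}\,P'$. Weak bisimilarity $\approx$ is the greatest relation $\mathcal{W}$ such that whenever $(P,Q)\in\mathcal{W}$, either $P=\mathsf{Sil}\,P'$, $Q=\mathsf{Sil}\,Q'$ with $(P',Q')\in\mathcal{W}$, or $P=\tau^m P'$, $Q=\tau^n Q'$ for some $m,n$ with $P',Q'$ stable and either $P'=Q'=\mathsf{Ret}\,x$ for some $x$, or $P'=\mathsf{Vis}\,F$, $Q'=\mathsf{Vis}\,G$ with $\mathrm{dom}(F)=\mathrm{dom}(G)$ and $(F(e),G(e))\in\mathcal{W}$ for all $e\in\mathrm{dom}(F)$. -}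

module Defs where

open import Level using (Level; suc; _⊔_; 0ℓ)
open import Data.Nat using (ℕ; zero) renaming (suc to 1+)
open import Data.Unit using (⊤; tt)
open import Data.Maybe using (Maybe; just; nothing; Is-just) renaming (map to mapMaybe)
open import Data.Product using (Σ; _×_; _,_)
open import Relation.Binary.PropositionalEquality using (_≡_)

-- We use the standard encoding of the final
-- coalgebra (M-type): an itree is a state of some coalgebra
--   step : St → Node St,
-- where Node is the one-step shape functor
--   X ↦ R + X + (E ⇀ X)     (Ret r | Sil P | Vis F, F a partial function).
-- Partial functions E ⇀ X are modelled as E → Maybe X.

module _ (E R : Set) where

  data Node {ℓ} (X : Set ℓ) : Set ℓ where
    ret : R → Node X
    sil : X → Node X
    vis : (E → Maybe X) → Node X

  record ITree : Set₁ where
    constructor itree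
    field
      St    : Set
      step  : St → Node St
      state : St

open ITree public

module _ {E R : Set} where

  mapNode : ∀ {a b} {X : Set a} {Y : Set b} → (X → Y) → Node E R X → Node E R Y
  mapNode f (ret r) = ret r
  mapNode f (sil x) = sil (f x)
  mapNode f (vis F) = vis (λ e → mapMaybe f (F e))

  out : ITree E R → Node E R (ITree E R)
  out (itree S st s) = mapNode (λ s′ → itree S st s′) (st s)

  Sil : ITree E R → ITree E R
  Sil (itree S st s) = itree (Maybe S) st′ nothing
    where
    st′ : Maybe S → Node E R (Maybe S)
    st′ nothing  = sil (just s)
    st′ (just x) = mapNode just (st x)

  τ^ : ℕ → ITree E R → ITree E R
  τ^ zero    P = P
  τ^ (1+ n)  P = Sil (τ^ n P)

  div : ITree E R
  div = itree ⊤ (λ _ → sil tt) tt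

  data _⇓_ : Node E R (ITree E R) → Node E R (ITree E R) → Set₁ where
    ⇓ret : ∀ {r} → ret r ⇓ ret r
    ⇓vis : ∀ {F} → vis F ⇓ vis F
    ⇓sil : ∀ {P s} → out P ⇓ s → sil P ⇓ s

  SameDom : (E → Maybe (ITree E R)) → (E → Maybe (ITree E R)) → Set₁
  SameDom F G = ∀ e → (Is-just (F e) → Is-just (G e)) × (Is-just (G e) → Is-just (F e))

  Rel₁ : Set₂
  Rel₁ = ITree E R → ITree E R → Set₁

  data WStep (W : Rel₁) : Node E R (ITree E R) → Node E R (ITree E R) → Set₁ where
    wsil : ∀ {P′ Q′} → W P′ Q′ → WStep W (sil P′) (sil Q′)
    wret : ∀ {s t x} → s ⇓ ret x → t ⇓ ret x → WStep W s t
    wvis : ∀ {s t F G} → s ⇓ vis F → t ⇓ vis G → SameDom F G →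
           (∀ e P′ Q′ → F e ≡ just P′ → G e ≡ just Q′ → W P′ Q′) → WStep W s t

  IsWeakBisim : Rel₁ → Set₁
  IsWeakBisim W = ∀ P Q → W P Q → WStep W (out P) (out Q)

  _≈_ : ITree E R → ITree E R → Set₂
  P ≈ Q = Σ Rel₁ λ W → IsWeakBisim W × W P Q

  -- Equality of itrees (elements of the coinductive datatype): strong
  -- bisimilarity, i.e. equality in the final coalgebra.
  data SStep (W : Rel₁) : Node E R (ITree E R) → Node E R (ITree E R) → Set₁ where
    sret : ∀ {r} → SStep W (ret r) (ret r)
    ssil : ∀ {P′ Q′} → W P′ Q′ → SStep W (sil P′) (sil Q′)
    svis : ∀ {F G} → SameDom F G →
           (∀ e P′ Q′ → F e ≡ just P′ → G e ≡ just Q′ → W P′ Q′) → SStep W (vis F) (vis G)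

  IsStrongBisim : Rel₁ → Set₁
  IsStrongBisim W = ∀ P Q → W P Q → SStep W (out P) (out Q)

  _≅_ : ITree E R → ITree E R → Set₂
  P ≅ Q = Σ Rel₁ λ W → IsStrongBisim W × W P Q

-- Nodes matched by a weak bisimulation converge to the same stable node:
-- following the bisimulation along the τ-steps of one side transports a
-- convergence of that side to the other.  This is what makes the composite of
-- two weak bisimulations one again; the converse relation gives symmetry.
-- Silent steps are absorbed because a strong bisimulation W, enlarged by the
-- pairs (A, B) with A = Sil A′ and W A′ B, is a weak bisimulation, and Sil P is
-- a τ in front of a copy of P.  A weak bisimulation can match div, which never
-- becomes stable, only by silent steps, so towards div it is a strong one.
module Submission where

open import Defs
open import Data.Nat using (ℕ; zero) renaming (suc to 1+)
open import Data.Product using (Σ; ∃; _×_; _,_; proj₁; proj₂)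
open import Data.Sum using (_⊎_; inj₁; inj₂)
open import Data.Empty using (⊥)
open import Data.Unit using (tt)
open import Data.Maybe using (Maybe; just; nothing; Is-just) renaming (map to mapMaybe)
open import Data.Maybe.Relation.Unary.Any using (just)
open import Data.Maybe.Relation.Binary.Pointwise using (Pointwise; just; nothing)
open import Function using (id; flip)
open import Relation.Binary.Construct.Composition using (_;_)
open import Relation.Binary.Structures using (IsEquivalence)
open import Relation.Binary.PropositionalEquality using (_≡_; refl; sym; subst)

module _ {E R : Set} where

  private
    Tree = ITree E R
    Branches = E → Maybe Tree
    Rel = Rel₁ {E} {R}

  ⇓-deterministic : ∀ {s u v : Node E R Tree} → s ⇓ u → s ⇓ v → u ≡ v
  ⇓-deterministic ⇓ret     ⇓ret     = refl
  ⇓-deterministic ⇓vis     ⇓vis     = refl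
  ⇓-deterministic (⇓sil p) (⇓sil q) = ⇓-deterministic p q

  SameDom-sym : ∀ {F G : Branches} → SameDom F G → SameDom G F
  SameDom-sym sd e = proj₂ (sd e) , proj₁ (sd e)

  SameDom-trans : ∀ {F G H : Branches} → SameDom F G → SameDom G H → SameDom F H
  SameDom-trans sd₁ sd₂ e =
    (λ x → proj₁ (sd₂ e) (proj₁ (sd₁ e) x)) , (λ x → proj₂ (sd₁ e) (proj₂ (sd₂ e) x))

  Children : Rel → Branches → Branches → Set₁
  Children W F G = ∀ e P′ Q′ → F e ≡ just P′ → G e ≡ just Q′ → W P′ Q′

  Children-flip : ∀ {W : Rel} {F G} → Children W F G → Children (flip W) G F
  Children-flip ch e Q′ P′ G≡ F≡ = ch e P′ Q′ F≡ G≡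

  Children-; : ∀ {W₁ W₂ : Rel} {F G H} →
               SameDom G H → Children W₁ F G → Children W₂ G H → Children (W₁ ; W₂) F H
  Children-; {G = G} sd ch₁ ch₂ e P′ S′ F≡ H≡ with G e in G≡ | proj₂ (sd e)
  ... | just Q′ | _   = Q′ , ch₁ e P′ Q′ F≡ G≡ , ch₂ e Q′ S′ G≡ H≡
  ... | nothing | H⇒G with () ← H⇒G (subst Is-just (sym H≡) (just tt))

  Pointwise⇒SameDom : ∀ {W : Rel} {F G} → (∀ e → Pointwise W (F e) (G e)) → SameDom F G
  Pointwise⇒SameDom {W} pw e = sameDom (pw e)
    where
    sameDom : ∀ {m n} → Pointwise W m n → (Is-just m → Is-just n) × (Is-just n → Is-just m)
    sameDom (just _) = (λ _ → just tt) , (λ _ → just tt)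
    sameDom nothing  = (λ ()) , (λ ())

  Pointwise⇒Children : ∀ {W : Rel} {F G} → (∀ e → Pointwise W (F e) (G e)) → Children W F G
  Pointwise⇒Children {W} pw e P′ Q′ F≡ G≡ = children (pw e) F≡ G≡
    where
    children : ∀ {m n} → Pointwise W m n → m ≡ just P′ → n ≡ just Q′ → W P′ Q′
    children (just w) refl refl = w
    children nothing  ()   _

  SStep⇒WStep : ∀ {W W′ : Rel} {s t} →
                (∀ {A B} → W A B → W′ A B) → SStep W s t → WStep W′ s t
  SStep⇒WStep f sret          = wret ⇓ret ⇓ret
  SStep⇒WStep f (ssil w)      = wsil (f w)
  SStep⇒WStep f (svis sd ch)  = wvis ⇓vis ⇓vis sd (λ e P′ Q′ F≡ G≡ → f (ch e P′ Q′ F≡ G≡))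

  IsStrongBisim⇒IsWeakBisim : ∀ {W : Rel} → IsStrongBisim W → IsWeakBisim W
  IsStrongBisim⇒IsWeakBisim bis P Q w = SStep⇒WStep id (bis P Q w)

  ≡-isStrongBisim : IsStrongBisim {E} {R} _≡_
  ≡-isStrongBisim P _ refl = SStep-refl (out P)
    where
    SStep-refl : ∀ s → SStep _≡_ s s
    SStep-refl (ret r) = sret
    SStep-refl (sil P′) = ssil refl
    SStep-refl (vis F) = svis (λ e → id , id) (Pointwise⇒Children (λ e → Pointwise-refl (F e)))
      where
      Pointwise-refl : ∀ m → Pointwise _≡_ m m
      Pointwise-refl (just P′) = just refl
      Pointwise-refl nothing   = nothing

  WStep-flip : ∀ {W : Rel} {s t} → WStep W s t → WStep (flip W) t s
  WStep-flip (wsil w)           = wsil w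
  WStep-flip (wret s⇓ t⇓)       = wret t⇓ s⇓
  WStep-flip (wvis s⇓ t⇓ sd ch) = wvis t⇓ s⇓ (SameDom-sym sd) (Children-flip ch)

  IsWeakBisim-flip : ∀ {W : Rel} → IsWeakBisim W → IsWeakBisim (flip W)
  IsWeakBisim-flip bis P Q w = WStep-flip (bis Q P w)

  WStep-retʳ : ∀ {W : Rel} {s t x} → IsWeakBisim W → WStep W s t → t ⇓ ret x → s ⇓ ret x
  WStep-retʳ bis (wsil {P′} {Q′} w) (⇓sil t⇓) = ⇓sil (WStep-retʳ bis (bis P′ Q′ w) t⇓)
  WStep-retʳ bis (wret s⇓ t⇓′) t⇓ with ⇓-deterministic t⇓ t⇓′
  ... | refl = s⇓
  WStep-retʳ bis (wvis s⇓ t⇓′ sd ch) t⇓ with ⇓-deterministic t⇓ t⇓′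
  ... | ()

  record VisMatch (W : Rel) (s : Node E R Tree) (G : Branches) : Set₁ where
    constructor visMatch
    field
      {F}      : Branches
      converge : s ⇓ vis F
      sameDom  : SameDom F G
      children : Children W F G

  WStep-visʳ : ∀ {W : Rel} {s t G} → IsWeakBisim W → WStep W s t → t ⇓ vis G → VisMatch W s G
  WStep-visʳ bis (wsil {P′} {Q′} w) (⇓sil t⇓) with WStep-visʳ bis (bis P′ Q′ w) t⇓
  ... | visMatch s⇓ sd ch = visMatch (⇓sil s⇓) sd ch
  WStep-visʳ bis (wret s⇓ t⇓′) t⇓ with ⇓-deterministic t⇓ t⇓′
  ... | ()
  WStep-visʳ bis (wvis s⇓ t⇓′ sd ch) t⇓ with ⇓-deterministic t⇓ t⇓′
  ... | refl = visMatch s⇓ sd ch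

  WStep-retˡ : ∀ {W : Rel} {s t x} → IsWeakBisim W → WStep W s t → s ⇓ ret x → t ⇓ ret x
  WStep-retˡ bis st = WStep-retʳ (IsWeakBisim-flip bis) (WStep-flip st)

  WStep-visˡ : ∀ {W : Rel} {s t F} → IsWeakBisim W → WStep W s t → s ⇓ vis F → VisMatch (flip W) t F
  WStep-visˡ bis st = WStep-visʳ (IsWeakBisim-flip bis) (WStep-flip st)

  WStep-; : ∀ {W₁ W₂ : Rel} {s t u} → IsWeakBisim W₁ → IsWeakBisim W₂ →
            WStep W₁ s t → WStep W₂ t u → WStep (W₁ ; W₂) s u
  WStep-; bis₁ bis₂ (wsil w₁) (wsil w₂) = wsil (_ , w₁ , w₂)
  WStep-; bis₁ bis₂ (wret s⇓ t⇓) st₂    = wret s⇓ (WStep-retˡ bis₂ st₂ t⇓)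
  WStep-; bis₁ bis₂ st₁ (wret t⇓ u⇓)    = wret (WStep-retʳ bis₁ st₁ t⇓) u⇓
  WStep-; bis₁ bis₂ (wvis s⇓ t⇓ sd ch) st₂ with WStep-visˡ bis₂ st₂ t⇓
  ... | visMatch u⇓ sd₂ ch₂ =
    wvis s⇓ u⇓ (SameDom-trans sd (SameDom-sym sd₂))
      (Children-; (SameDom-sym sd₂) ch (Children-flip ch₂))
  WStep-; bis₁ bis₂ st₁@(wsil _) (wvis t⇓ u⇓ sd ch) with WStep-visʳ bis₁ st₁ t⇓
  ... | visMatch s⇓ sd₁ ch₁ = wvis s⇓ u⇓ (SameDom-trans sd₁ sd) (Children-; sd ch₁ ch)

  IsWeakBisim-; : ∀ {W₁ W₂ : Rel} → IsWeakBisim W₁ → IsWeakBisim W₂ → IsWeakBisim (W₁ ; W₂)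
  IsWeakBisim-; bis₁ bis₂ P S (Q , w₁ , w₂) = WStep-; bis₁ bis₂ (bis₁ P Q w₁) (bis₂ Q S w₂)

  ≈-refl : ∀ {P : Tree} → P ≈ P
  ≈-refl = _≡_ , IsStrongBisim⇒IsWeakBisim ≡-isStrongBisim , refl

  ≈-sym : ∀ {P Q : Tree} → P ≈ Q → Q ≈ P
  ≈-sym (W , bis , w) = flip W , IsWeakBisim-flip bis , w

  ≈-trans : ∀ {P Q S : Tree} → P ≈ Q → Q ≈ S → P ≈ S
  ≈-trans (W₁ , bis₁ , w₁) (W₂ , bis₂ , w₂) = W₁ ; W₂ , IsWeakBisim-; bis₁ bis₂ , (_ , w₁ , w₂)

  ≈-isEquivalence : IsEquivalence (_≈_ {E} {R})
  ≈-isEquivalence = record { refl = ≈-refl ; sym = ≈-sym ; trans = ≈-trans }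

  Delayed : Rel → Rel
  Delayed W A B = W A B ⊎ ∃ λ A′ → out A ≡ sil A′ × W A′ B

  Delayed-isWeakBisim : ∀ {W : Rel} → IsStrongBisim W → IsWeakBisim (Delayed W)
  Delayed-isWeakBisim bis A B (inj₁ w) = SStep⇒WStep inj₁ (bis A B w)
  Delayed-isWeakBisim {W} bis A B (inj₂ (A′ , A≡ , w)) =
    subst (λ s → WStep (Delayed W) s (out B)) (sym A≡) (delay refl (bis A′ B w))
    where
    delay : ∀ {s t} → out A′ ≡ s → SStep W s t → WStep (Delayed W) (sil A′) t
    delay A′≡ sret          = wret (⇓sil (subst (_⇓ _) (sym A′≡) ⇓ret)) ⇓ret
    delay A′≡ (ssil w′)     = wsil (inj₂ (_ , A′≡ , w′))
    delay A′≡ (svis sd ch)  =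
      wvis (⇓sil (subst (_⇓ _) (sym A′≡) ⇓vis)) ⇓vis sd (λ e P′ Q′ F≡ G≡ → inj₁ (ch e P′ Q′ F≡ G≡))

  -- The states of Sil P are those of P plus a fresh root; a state y of P seen
  -- inside Sil P is related to y itself.
  Lifted : Rel
  Lifted A B = Σ Tree λ P → Σ (St P) λ y →
    A ≡ itree (Maybe (St P)) (step (Sil P)) (just y) × B ≡ itree (St P) (step P) y

  Lifted-isStrongBisim : IsStrongBisim Lifted
  Lifted-isStrongBisim A B (itree S st x , y , refl , refl) with st y
  ... | ret r = sret
  ... | sil z = ssil (itree S st x , z , refl , refl)
  ... | vis H =
    svis (Pointwise⇒SameDom (λ e → lifted (H e))) (Pointwise⇒Children (λ e → lifted (H e)))
    where
    lifted : (m : Maybe S) → Pointwise Lifted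
      (mapMaybe (itree (Maybe S) (step (Sil (itree S st x)))) (mapMaybe just m))
      (mapMaybe (itree S st) m)
    lifted nothing  = nothing
    lifted (just z) = just (itree S st x , z , refl , refl)

  Sil≈ : ∀ (P : Tree) → Sil P ≈ P
  Sil≈ P =
    Delayed Lifted , Delayed-isWeakBisim Lifted-isStrongBisim , inj₂ (_ , refl , (P , state P , refl , refl))

  τ^≈ : ∀ m (P : Tree) → τ^ m P ≈ P
  τ^≈ zero   P = ≈-refl
  τ^≈ (1+ m) P = ≈-trans (Sil≈ (τ^ m P)) (τ^≈ m P)

  τ^-cong-≈ : ∀ (P Q : Tree) (m n : ℕ) → P ≈ Q → τ^ m P ≈ τ^ n Q
  τ^-cong-≈ P Q m n P≈Q = ≈-trans (τ^≈ m P) (≈-trans P≈Q (≈-sym (τ^≈ n Q)))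

  sil-div-diverges : ∀ {s : Node E R Tree} → sil div ⇓ s → ⊥
  sil-div-diverges (⇓sil d) = sil-div-diverges d

  ≈div⇒≅div : ∀ (P : Tree) → P ≈ div → P ≅ div
  ≈div⇒≅div P (W , bis , w) = W′ , isStrongBisim , (w , refl)
    where
    W′ : Rel
    W′ A B = W A B × B ≡ div

    isStrongBisim : IsStrongBisim W′
    isStrongBisim A B (w′ , refl) = silent (bis A div w′)
      where
      silent : ∀ {s} → WStep W s (sil div) → SStep W′ s (sil div)
      silent (wsil w″)       = ssil (w″ , refl)
      silent (wret _ d)      with () ← sil-div-diverges d
      silent (wvis _ d _ _)  with () ← sil-div-diverges d

mainTheorem7 : {E R : Set} →
    IsEquivalence (_≈_ {E} {R})
    × (∀ (P Q : ITree E R) (m n : ℕ) → P ≈ Q → τ^ m P ≈ τ^ n Q)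
    × (∀ (P : ITree E R) → P ≈ div → P ≅ div)
mainTheorem7 = ≈-isEquivalence , τ^-cong-≈ , ≈div⇒≅div
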